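{- Let $G$ be a simple graph of odd order $n$ with $m$ edges. If every two distinct non-adjacent vertices $u,v\in V(G)$ satisfy $d(u)+d(v)\ge n+2$, then $m\ge \frac14 n^2+\frac12 n-\frac34$.
   Context: $d(v)$ denotes the degree of vertex $v$ in $G$. -}

module Defs where

open import Data.Nat using (ℕ; _+_; _<_)
open import Data.Fin using (Fin; toℕ)
open import Data.Fin.Properties using (_<?_)
open import Data.List using (List; length; filter; allFin; cartesianProduct)
open import Data.Product using (_×_; _,_; proj₁; proj₂)
open import Relation.Nullary using (¬_; Dec)
open import Relation.Binary.PropositionalEquality using (_≡_)
open import Relation.Nullary.Decidable using (_×-dec_)

record SimpleGraph (n : ℕ) : Set₁ where
  field
    Adj     : Fin n → Fin n → Set
    adj?    : ∀ u v → Dec (Adj u v)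
    sym     : ∀ {u v} → Adj u v → Adj v u
    irrefl  : ∀ {u} → ¬ Adj u u

open SimpleGraph public

degree : ∀ {n} → SimpleGraph n → Fin n → ℕ
degree G v = length (filter (λ u → adj? G v u) (allFin _))

edgeCount : ∀ {n} → SimpleGraph n → ℕ
edgeCount {n} G =
  length (filter (λ p → (proj₁ p <? proj₂ p) ×-dec adj? G (proj₁ p) (proj₂ p))
                 (cartesianProduct (allFin n) (allFin n)))

-- Let v be a vertex of minimum degree δ and let B = n − δ count the vertices
-- not adjacent to v, v itself included. Every neighbour of v has degree at
-- least δ, and by the degree condition every other non-neighbour has degree
-- at least n + 2 − δ = B + 2. Summing and applying the handshake lemma gives
-- 2m ≥ δ² + (B − 1)(B + 2) + δ, which rearranges to
-- 4m + 4 ≥ n² + 2n + (δ − B)². As n = δ + B is odd, δ ≠ B, so (δ − B)² ≥ 1.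
module Submission where

open import Defs
open import Data.Nat using (ℕ; _+_; _*_; _≤_; _≥_)
open import Data.Nat.DivMod using (_%_)
open import Data.Fin using (Fin)
open import Relation.Nullary using (¬_)
open import Relation.Binary.PropositionalEquality using (_≡_)

open import Level using (Level)
open import Data.Bool.Base using (true; false; if_then_else_)
open import Data.Nat.Base using (zero; suc; _<_; s≤s; z≤n)
open import Data.Nat.Properties
  using (≤-totalOrder; +-identityʳ; +-comm; +-assoc; +-mono-≤; +-monoˡ-≤; +-monoʳ-≤; *-monoʳ-≤;
         +-cancelˡ-≤; +-cancelʳ-≤; m<m+n; m≤n⇒∃[o]m+o≡n; module ≤-Reasoning)
import Data.Nat.Properties as ℕ
open import Data.Nat.DivMod using (m*n%n≡0)
open import Data.Nat.Tactic.RingSolver using (solve-∀)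
import Data.Nat.ListAction as List
open import Data.Nat.ListAction.Properties using (sum-++)
open import Data.Fin.Base as Fin using (punchIn) renaming (zero to 0F; suc to 1+)
open import Data.Fin.Properties using (_<?_; <-cmp; <-irrefl; punchInᵢ≢i)
open import Data.List.Base using (List; []; _∷_; _++_; length; filter; map; tabulate; allFin; cartesianProduct)
open import Data.List.Properties using (map-++; map-∘)
open import Data.List.Extrema ≤-totalOrder using (argmin; f[argmin]≤f[xs])
open import Data.List.Membership.Propositional.Properties using (∈-allFin)
import Data.List.Relation.Unary.All as All
open import Data.Product.Base using (_×_; _,_; proj₁; proj₂; ∃-syntax)
open import Function.Base using (_∘_; id)
open import Function.Bundles using (_⇔_; mk⇔)
open import Relation.Nullary.Decidable using (Dec; yes; no; does; ¬?; _×-dec_; dec-false; does-⇔)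
open import Relation.Nullary.Negation using (contradiction)
open import Relation.Unary using (Pred; Decidable)
open import Relation.Binary.Definitions using (tri<; tri≈; tri>)
open import Relation.Binary.PropositionalEquality as ≡ using (_≢_; refl; cong; cong₂; subst; subst₂; module ≡-Reasoning)
open import Algebra.Properties.Semiring.Sum ℕ.+-*-semiring
  using (sum-syntax; sum-cong-≗; ∑-distrib-+; ∑-comm; sum-remove; *-distribʳ-sum)

private
  variable
    p q : Level
    A : Set p

𝟙 : Dec A → ℕ
𝟙 a? = if does a? then 1 else 0

𝟙-no : (a? : Dec A) → ¬ A → 𝟙 a? ≡ 0
𝟙-no a? ¬a rewrite dec-false a? ¬a = refl

𝟙-⇔ : {B : Set q} → A ⇔ B → (a? : Dec A) (b? : Dec B) → 𝟙 a? ≡ 𝟙 b?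
𝟙-⇔ A⇔B a? b? rewrite does-⇔ A⇔B a? b? = refl

𝟙+𝟙¬ : (a? : Dec A) → 𝟙 a? + 𝟙 (¬? a?) ≡ 1
𝟙+𝟙¬ a? with does a?
... | true  = refl
... | false = refl

if-does≡𝟙*+𝟙¬* : (a? : Dec A) (x y : ℕ) → (if does a? then x else y) ≡ 𝟙 a? * x + 𝟙 (¬? a?) * y
if-does≡𝟙*+𝟙¬* a? x y with does a?
... | true  = ≡.sym (≡.trans (+-identityʳ (x + 0)) (+-identityʳ x))
... | false = ≡.sym (+-identityʳ y)

∑-mono-≤ : ∀ {n} {f g : Fin n → ℕ} → (∀ i → f i ≤ g i) → ∑[ i < n ] f i ≤ ∑[ i < n ] g i
∑-mono-≤ {zero}  f≤g = z≤n
∑-mono-≤ {suc n} f≤g = +-mono-≤ (f≤g 0F) (∑-mono-≤ (f≤g ∘ 1+))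

∑-const-1 : ∀ n → ∑[ i < n ] 1 ≡ n
∑-const-1 zero    = refl
∑-const-1 (suc n) = cong suc (∑-const-1 n)

∑-if-does : ∀ {n} {P : Pred (Fin n) p} (P? : Decidable P) (x y : ℕ) →
  ∑[ i < n ] (if does (P? i) then x else y) ≡
  (∑[ i < n ] 𝟙 (P? i)) * x + (∑[ i < n ] 𝟙 (¬? (P? i))) * y
∑-if-does {n = n} P? x y = begin
  ∑[ i < n ] (if does (P? i) then x else y)
    ≡⟨ sum-cong-≗ (λ i → if-does≡𝟙*+𝟙¬* (P? i) x y) ⟩
  ∑[ i < n ] (𝟙 (P? i) * x + 𝟙 (¬? (P? i)) * y)
    ≡⟨ ∑-distrib-+ (λ i → 𝟙 (P? i) * x) (λ i → 𝟙 (¬? (P? i)) * y) ⟩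
  ∑[ i < n ] (𝟙 (P? i) * x) + ∑[ i < n ] (𝟙 (¬? (P? i)) * y)
    ≡⟨ cong₂ _+_ (*-distribʳ-sum x (𝟙 ∘ P?)) (*-distribʳ-sum y (𝟙 ∘ ¬? ∘ P?)) ⟨
  (∑[ i < n ] 𝟙 (P? i)) * x + (∑[ i < n ] 𝟙 (¬? (P? i))) * y ∎
  where open ≡-Reasoning

∃-minimiser : ∀ {n} (f : Fin (suc n) → ℕ) → ∃[ v ] (∀ u → f v ≤ f u)
∃-minimiser f = argmin f 0F (allFin _) , λ u → All.lookup (f[argmin]≤f[xs] {f = f} 0F (allFin _)) (∈-allFin u)

length-filter≡sum : ∀ {P : Pred A p} (P? : Decidable P) xs →
  length (filter P? xs) ≡ List.sum (map (𝟙 ∘ P?) xs)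
length-filter≡sum P? []       = refl
length-filter≡sum P? (x ∷ xs) with does (P? x)
... | true  = cong suc (length-filter≡sum P? xs)
... | false = length-filter≡sum P? xs

sum-map-tabulate : ∀ {n} (f : A → ℕ) (g : Fin n → A) →
  List.sum (map f (tabulate g)) ≡ ∑[ i < n ] f (g i)
sum-map-tabulate {n = zero}  f g = refl
sum-map-tabulate {n = suc n} f g = cong (f (g 0F) +_) (sum-map-tabulate f (g ∘ 1+))

sum-map-cartesianProduct : {B : Set q} (f : A × B → ℕ) (xs : List A) (ys : List B) →
  List.sum (map f (cartesianProduct xs ys)) ≡
  List.sum (map (λ x → List.sum (map (λ y → f (x , y)) ys)) xs)
sum-map-cartesianProduct f []       ys = refl
sum-map-cartesianProduct f (x ∷ xs) ys = begin
  List.sum (map f (map (x ,_) ys ++ cartesianProduct xs ys))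
    ≡⟨ cong List.sum (map-++ f (map (x ,_) ys) _) ⟩
  List.sum (map f (map (x ,_) ys) ++ map f (cartesianProduct xs ys))
    ≡⟨ sum-++ (map f (map (x ,_) ys)) _ ⟩
  List.sum (map f (map (x ,_) ys)) + List.sum (map f (cartesianProduct xs ys))
    ≡⟨ cong₂ _+_ (cong List.sum (≡.sym (map-∘ ys))) (sum-map-cartesianProduct f xs ys) ⟩
  List.sum (map (λ y → f (x , y)) ys) + List.sum (map (λ x → List.sum (map (λ y → f (x , y)) ys)) xs) ∎
  where open ≡-Reasoning

OreCondition : ∀ {n} → SimpleGraph n → ℕ → Set
OreCondition G s = ∀ u v → ¬ (u ≡ v) → ¬ Adj G u v → degree G u + degree G v ≥ s

module _ {n} (G : SimpleGraph n) where

  edge? : ∀ u w → Dec (u Fin.< w × Adj G u w)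
  edge? u w = (u <? w) ×-dec adj? G u w

  degree≡∑ : ∀ u → degree G u ≡ ∑[ w < n ] 𝟙 (adj? G u w)
  degree≡∑ u = ≡.trans (length-filter≡sum (adj? G u) (allFin n)) (sum-map-tabulate (𝟙 ∘ adj? G u) id)

  edgeCount≡∑ : edgeCount G ≡ ∑[ u < n ] ∑[ w < n ] 𝟙 (edge? u w)
  edgeCount≡∑ = begin
    edgeCount G
      ≡⟨ length-filter≡sum _ (cartesianProduct (allFin n) (allFin n)) ⟩
    List.sum (map (λ e → 𝟙 (edge? (proj₁ e) (proj₂ e))) (cartesianProduct (allFin n) (allFin n)))
      ≡⟨ sum-map-cartesianProduct (λ e → 𝟙 (edge? (proj₁ e) (proj₂ e))) (allFin n) (allFin n) ⟩
    List.sum (map (λ u → List.sum (map (𝟙 ∘ edge? u) (allFin n))) (allFin n))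
      ≡⟨ sum-map-tabulate (λ u → List.sum (map (𝟙 ∘ edge? u) (allFin n))) id ⟩
    ∑[ u < n ] List.sum (map (𝟙 ∘ edge? u) (allFin n))
      ≡⟨ sum-cong-≗ (λ u → sum-map-tabulate (𝟙 ∘ edge? u) id) ⟩
    ∑[ u < n ] ∑[ w < n ] 𝟙 (edge? u w) ∎
    where open ≡-Reasoning

  𝟙-adj≡𝟙-edge+𝟙-edge : ∀ u w → 𝟙 (adj? G u w) ≡ 𝟙 (edge? u w) + 𝟙 (edge? w u)
  𝟙-adj≡𝟙-edge+𝟙-edge u w with <-cmp u w
  ... | tri< u<w _ w≮u
    rewrite 𝟙-no (edge? w u) (w≮u ∘ proj₁) | +-identityʳ (𝟙 (edge? u w))
    = 𝟙-⇔ (mk⇔ (u<w ,_) proj₂) (adj? G u w) (edge? u w)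
  ... | tri> u≮w _ w<u
    rewrite 𝟙-no (edge? u w) (u≮w ∘ proj₁)
    = 𝟙-⇔ (mk⇔ (λ a → w<u , sym G a) (sym G ∘ proj₂)) (adj? G u w) (edge? w u)
  ... | tri≈ _ refl _
    rewrite 𝟙-no (adj? G u u) (irrefl G) | 𝟙-no (edge? u u) (<-irrefl refl ∘ proj₁)
    = refl

  handshake : ∑[ u < n ] degree G u ≡ 2 * edgeCount G
  handshake = begin
    ∑[ u < n ] degree G u
      ≡⟨ sum-cong-≗ (λ u → ≡.trans (degree≡∑ u) (sum-cong-≗ (𝟙-adj≡𝟙-edge+𝟙-edge u))) ⟩
    ∑[ u < n ] ∑[ w < n ] (𝟙 (edge? u w) + 𝟙 (edge? w u))
      ≡⟨ sum-cong-≗ (λ u → ∑-distrib-+ (𝟙 ∘ edge? u) (λ w → 𝟙 (edge? w u))) ⟩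
    ∑[ u < n ] (∑[ w < n ] 𝟙 (edge? u w) + ∑[ w < n ] 𝟙 (edge? w u))
      ≡⟨ ∑-distrib-+ (λ u → ∑[ w < n ] 𝟙 (edge? u w)) (λ u → ∑[ w < n ] 𝟙 (edge? w u)) ⟩
    E + ∑[ u < n ] ∑[ w < n ] 𝟙 (edge? w u)
      ≡⟨ cong (E +_) (∑-comm (λ u w → 𝟙 (edge? u w))) ⟨
    E + E
      ≡⟨ cong (E +_) (+-identityʳ E) ⟨
    2 * E
      ≡⟨ cong (2 *_) edgeCount≡∑ ⟨
    2 * edgeCount G ∎
    where
      open ≡-Reasoning
      E : ℕ
      E = ∑[ u < n ] ∑[ w < n ] 𝟙 (edge? u w)

  nonNeighbourCount : Fin n → ℕ
  nonNeighbourCount v = ∑[ u < n ] 𝟙 (¬? (adj? G v u))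

  degree+nonNeighbourCount≡n : ∀ v → degree G v + nonNeighbourCount v ≡ n
  degree+nonNeighbourCount≡n v = begin
    degree G v + nonNeighbourCount v
      ≡⟨ cong (_+ nonNeighbourCount v) (degree≡∑ v) ⟩
    ∑[ u < n ] 𝟙 (adj? G v u) + ∑[ u < n ] 𝟙 (¬? (adj? G v u))
      ≡⟨ ∑-distrib-+ (𝟙 ∘ adj? G v) (𝟙 ∘ ¬? ∘ adj? G v) ⟨
    ∑[ u < n ] (𝟙 (adj? G v u) + 𝟙 (¬? (adj? G v u)))
      ≡⟨ sum-cong-≗ (𝟙+𝟙¬ ∘ adj? G v) ⟩
    ∑[ u < n ] 1
      ≡⟨ ∑-const-1 n ⟩
    n ∎
    where open ≡-Reasoning

module _ {k} (G : SimpleGraph (suc k)) (ore : OreCondition G (suc k + 2))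
         {v} (v-minimal : ∀ u → degree G v ≤ degree G u) where

  private
    δ B : ℕ
    δ = degree G v
    B = nonNeighbourCount G v

  degreeLowerBound : Fin (suc k) → ℕ
  degreeLowerBound u = if does (adj? G v u) then δ else B + 2

  degreeLowerBound≤degree : ∀ u → u ≢ v → degreeLowerBound u ≤ degree G u
  degreeLowerBound≤degree u u≢v with adj? G v u
  ... | yes _    = v-minimal u
  ... | no ¬v~u  = +-cancelˡ-≤ δ (B + 2) (degree G u) (begin
    δ + (B + 2)      ≡⟨ +-assoc δ B 2 ⟨
    δ + B + 2        ≡⟨ cong (_+ 2) (degree+nonNeighbourCount≡n G v) ⟩
    suc k + 2        ≤⟨ ore u v u≢v (¬v~u ∘ sym G) ⟩
    degree G u + δ   ≡⟨ +-comm (degree G u) δ ⟩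
    δ + degree G u   ∎)
    where open ≤-Reasoning

  degreeLowerBound-self : degreeLowerBound v ≡ B + 2
  degreeLowerBound-self with adj? G v v
  ... | yes v~v = contradiction v~v (irrefl G)
  ... | no _    = refl

  ∑-degreeLowerBound : ∑[ u < suc k ] degreeLowerBound u ≡ δ * δ + B * (B + 2)
  ∑-degreeLowerBound =
    ≡.trans (∑-if-does (adj? G v) δ (B + 2)) (cong (λ d → d * δ + B * (B + 2)) (≡.sym (degree≡∑ G v)))

  -- The sum of degreeLowerBound charges v with B + 2 rather than δ; both sides
  -- carry the difference so that no subtraction occurs.
  edgeCount-lower-bound : δ + (δ * δ + B * (B + 2)) ≤ 2 * edgeCount G + (B + 2)
  edgeCount-lower-bound = begin
    δ + (δ * δ + B * (B + 2))
      ≡⟨ cong (δ +_) ∑-degreeLowerBound ⟨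
    δ + ∑[ u < suc k ] degreeLowerBound u
      ≡⟨ cong (δ +_) (sum-remove {i = v} degreeLowerBound) ⟩
    δ + (degreeLowerBound v + ∑-others degreeLowerBound)
      ≡⟨ cong (λ b → δ + (b + ∑-others degreeLowerBound)) degreeLowerBound-self ⟩
    δ + ((B + 2) + ∑-others degreeLowerBound)
      ≤⟨ +-monoʳ-≤ δ (+-monoʳ-≤ (B + 2) (∑-mono-≤ λ j → degreeLowerBound≤degree (punchIn v j) (punchInᵢ≢i v j))) ⟩
    δ + ((B + 2) + ∑-others (degree G))
      ≡⟨ cong (δ +_) (+-comm (B + 2) (∑-others (degree G))) ⟩
    δ + (∑-others (degree G) + (B + 2))
      ≡⟨ +-assoc δ (∑-others (degree G)) (B + 2) ⟨
    δ + ∑-others (degree G) + (B + 2)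
      ≡⟨ cong (_+ (B + 2)) (sum-remove {i = v} (degree G)) ⟨
    ∑[ u < suc k ] degree G u + (B + 2)
      ≡⟨ cong (_+ (B + 2)) (handshake G) ⟩
    2 * edgeCount G + (B + 2) ∎
    where
      open ≤-Reasoning
      ∑-others : (Fin (suc k) → ℕ) → ℕ
      ∑-others f = ∑[ j < k ] f (punchIn v j)

x<y⇒[x+y]²<2[x²+y²] : ∀ {x y} → x < y → (x + y) * (x + y) < 2 * (x * x + y * y)
x<y⇒[x+y]²<2[x²+y²] {x} x<y with (t , refl) ← m≤n⇒∃[o]m+o≡n x<y =
  subst (square <_) (gap x t) (m<m+n square (s≤s z≤n))
  where
    square : ℕ
    square = (x + (suc x + t)) * (x + (suc x + t))
    gap : ∀ x t → (x + (suc x + t)) * (x + (suc x + t)) + suc t * suc t ≡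
                  2 * (x * x + (suc x + t) * (suc x + t))
    gap = solve-∀

x≢y⇒[x+y]²<2[x²+y²] : ∀ {x y} → x ≢ y → (x + y) * (x + y) < 2 * (x * x + y * y)
x≢y⇒[x+y]²<2[x²+y²] {x} {y} x≢y with ℕ.<-cmp x y
... | tri< x<y _ _ = x<y⇒[x+y]²<2[x²+y²] x<y
... | tri≈ _ x≡y _ = contradiction x≡y x≢y
... | tri> _ _ y<x = subst₂ _<_ (cong (λ s → s * s) (+-comm y x)) (cong (2 *_) (+-comm (y * y) (x * x)))
                            (x<y⇒[x+y]²<2[x²+y²] y<x)

odd-sum⇒≢ : ∀ {x y} → (x + y) % 2 ≡ 1 → x ≢ y
odd-sum⇒≢ {x} odd refl =
  contradiction (≡.trans (≡.sym (m*n%n≡0 x 2)) (≡.trans (cong (_% 2) (double x)) odd)) λ ()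
  where
    double : ∀ x → x * 2 ≡ x + x
    double = solve-∀

quadratic-bound : ∀ m x y {n} → x + y ≡ n → n % 2 ≡ 1 →
  x + (x * x + y * (y + 2)) ≤ 2 * m + (y + 2) → n * n + 2 * n ≤ 4 * m + 3
quadratic-bound m x y refl odd bound =
  +-cancelʳ-≤ (2 * y + 1) ((x + y) * (x + y) + 2 * (x + y)) (4 * m + 3) (begin
  (x + y) * (x + y) + 2 * (x + y) + (2 * y + 1)   ≡⟨ e₁ x y ⟩
  suc ((x + y) * (x + y)) + 2 * (x + 2 * y)        ≤⟨ +-monoˡ-≤ (2 * (x + 2 * y)) [x+y]²<2[x²+y²] ⟩
  2 * (x * x + y * y) + 2 * (x + 2 * y)            ≡⟨ e₂ x y ⟩
  2 * (x + (x * x + y * (y + 2)))                  ≤⟨ *-monoʳ-≤ 2 bound ⟩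
  2 * (2 * m + (y + 2))                            ≡⟨ e₃ m y ⟩
  4 * m + 3 + (2 * y + 1)                          ∎)
  where
    open ≤-Reasoning
    [x+y]²<2[x²+y²] : (x + y) * (x + y) < 2 * (x * x + y * y)
    [x+y]²<2[x²+y²] = x≢y⇒[x+y]²<2[x²+y²] (odd-sum⇒≢ {x} {y} odd)
    e₁ : ∀ x y → (x + y) * (x + y) + 2 * (x + y) + (2 * y + 1) ≡ suc ((x + y) * (x + y)) + 2 * (x + 2 * y)
    e₁ = solve-∀
    e₂ : ∀ x y → 2 * (x * x + y * y) + 2 * (x + 2 * y) ≡ 2 * (x + (x * x + y * (y + 2)))
    e₂ = solve-∀
    e₃ : ∀ m y → 2 * (2 * m + (y + 2)) ≡ 4 * m + 3 + (2 * y + 1)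
    e₃ = solve-∀

lemma2 : (n : ℕ) → n % 2 ≡ 1 → (G : SimpleGraph n) →
    (∀ (u v : Fin n) → ¬ (u ≡ v) → ¬ Adj G u v →
      degree G u + degree G v ≥ n + 2) →
    4 * edgeCount G + 3 ≥ n * n + 2 * n
lemma2 zero () G ore
lemma2 (suc k) odd G ore =
  let v , v-minimal = ∃-minimiser (degree G) in
  quadratic-bound (edgeCount G) (degree G v) (nonNeighbourCount G v)
    (degree+nonNeighbourCount≡n G v) odd (edgeCount-lower-bound G ore v-minimal)
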